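{- For every cycle $C_n$ ($n\ge 3$), $\mathrm{Maj}(C_n)=2$ if $n\equiv 0 \pmod 4$, and $\mathrm{Maj}(C_n)=3$ otherwise.
   Context: A strong majority vertex-coloring of a graph $G=(V,E)$ is a (not necessarily proper) map $c:V\to C$ into a set $C$ of colors such that for every vertex $v\in V$ and every color $\alpha\in C$, at most half of the neighbors of $v$ have color $\alpha$. The strong majority number $\mathrm{Maj}(G)$ is the least number of colors in such a coloring. -}

module Defs where

open import Data.Nat using (ℕ; zero; suc; _+_; _*_; _≤_; _<_; NonZero)
open import Data.Nat.DivMod using (_%_)
open import Data.Fin using (Fin; toℕ)
open import Data.Fin.Properties using (_≟_)
open import Data.Bool using (Bool; true; false; _∧_; _∨_; if_then_else_)
open import Data.List using (List; length; filter)
open import Data.List using () renaming (allFin to allFinL)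
open import Data.Product using (Σ; ∃; _×_; _,_)
open import Relation.Nullary using (¬_; does)
open import Relation.Binary.PropositionalEquality using (_≡_)
open import Data.Nat using () renaming (_≟_ to _≟ℕ_)

record Graph : Set where
  field
    order : ℕ
    adj   : Fin order → Fin order → Bool
    adj-sym   : ∀ u v → adj u v ≡ adj v u
    adj-irrefl : ∀ v → adj v v ≡ false
open Graph public

count : ∀ {n} → (Fin n → Bool) → ℕ
count {n} p = length (filter (λ i → Data.Bool._≟_ (p i) true) (allFinL n))

degree : (G : Graph) → Fin (order G) → ℕ
degree G v = count (λ u → adj G v u)

colourDegree : (G : Graph) {k : ℕ} → (Fin (order G) → Fin k) → Fin (order G) → Fin k → ℕ
colourDegree G c v α = count (λ u → adj G v u ∧ does (c u ≟ α))

IsStrongMajority : (G : Graph) {k : ℕ} → (Fin (order G) → Fin k) → Set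
IsStrongMajority G c = ∀ v α → 2 * colourDegree G c v α ≤ degree G v

MajColourable : Graph → ℕ → Set
MajColourable G k = Σ (Fin (order G) → Fin k) (IsStrongMajority G)

MajNumber : Graph → ℕ → Set
MajNumber G m = MajColourable G m × (∀ k → k < m → ¬ MajColourable G k)

cycleAdj : (n : ℕ) → .{{NonZero n}} → Fin n → Fin n → Bool
cycleAdj n i j = does ((suc (toℕ i) % n) ≟ℕ toℕ j) ∨ does ((suc (toℕ j) % n) ≟ℕ toℕ i)

private
  open import Data.Nat.Properties using (1+n≢n)
  open import Data.Nat.DivMod using (m<n⇒m%n≡m; n%n≡0)
  open import Data.Fin.Properties using (toℕ<n)
  open import Data.Nat using (_≤?_; s≤s; z≤n) renaming (_≟_ to _≟'_)
  open import Data.Bool.Properties using (∨-comm)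
  open import Relation.Nullary using (yes; no)
  open import Relation.Binary.PropositionalEquality using (refl; sym; trans; cong)
  open import Data.Empty using (⊥-elim)
  import Relation.Nullary.Decidable
  open import Data.Nat.Properties using (≰⇒>)

  step-neq : ∀ n .{{_ : NonZero n}} → 2 ≤ n → (i : Fin n) →
             ¬ (suc (toℕ i) % n ≡ toℕ i)
  step-neq n h i eq with suc (toℕ i) Data.Nat.≟ n
  ... | yes e = bad n h (toℕ i) e eq
    where
      bad : ∀ n .{{_ : NonZero n}} → 2 ≤ n → (j : ℕ) → suc j ≡ n → suc j % n ≡ j → Data.Empty.⊥
      bad .1 (s≤s ()) zero refl eq'
      bad .(suc (suc m)) h' (suc m) refl eq' = Data.Nat.Properties.0≢1+n (trans (sym (n%n≡0 (suc (suc m)))) eq')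
  ... | no ne = 1+n≢n (trans (sym (m<n⇒m%n≡m lt)) eq)
    where
      lt : suc (toℕ i) < n
      lt = Data.Nat.Properties.≤∧≢⇒< (toℕ<n i) ne

  does-false : ∀ {a b : ℕ} → ¬ (a ≡ b) → does (a ≟ℕ b) ≡ false
  does-false {a} {b} ne = Relation.Nullary.Decidable.dec-false (a ≟ℕ b) ne

Cycle : (n : ℕ) → 3 ≤ n → Graph
Cycle (suc (suc zero)) (s≤s (s≤s ()))
Cycle n@(suc (suc (suc m))) h = record
  { order = n
  ; adj = cycleAdj n
  ; adj-sym = λ u v → ∨-comm (does ((suc (toℕ u) % n) ≟ℕ toℕ v)) (does ((suc (toℕ v) % n) ≟ℕ toℕ u))
  ; adj-irrefl = λ v → cong₂∨ (does-false (step-neq n (s≤s (s≤s z≤n)) v))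
  }
  where
    cong₂∨ : ∀ {b} → b ≡ false → (b ∨ b) ≡ false
    cong₂∨ refl = refl

{-# OPTIONS --safe #-}
-- In C_n every vertex next w has exactly the two neighbours w and next (next w), so c is a
-- strong majority colouring iff c w ≢ c (next (next w)) for all w, i.e. iff c properly
-- colours the graph i ~ i + 2 (mod n).  One colour never does.  With two colours, read along
-- ℕ as i ↦ c (i mod n), c (i + 2) is forced to be the other colour of c i, so the sequence
-- has period 4 as well as period n; as some multiple of n is ≡ 2 (mod 4) unless 4 ∣ n, this
-- is impossible for 4 ∤ n.  Conversely a a b b a a b b … works when 4 ∣ n; otherwise
-- recolouring positions 0 and 1 with a third colour repairs the only possible clashes, the
-- wrap-around pairs (n - 2, 0) and (n - 1, 1), as long as n ≥ 4; for n = 3 three distinct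
-- colours work.
module Submission where

open import Defs
open import Data.Nat using (ℕ; _≤_; _%_)
open import Relation.Binary.PropositionalEquality using (_≡_; _≢_)
open import Data.Product using (_×_)

open import Data.Bool using (Bool; true; false; _∧_; _∨_) renaming (_≟_ to _≟ᵇ_)
open import Data.Bool.Properties using (∧-identityʳ; ∨-identityʳ)
open import Data.Empty using (⊥-elim)
open import Data.Fin using (Fin; zero; suc; toℕ; fromℕ; inject₁)
open import Data.Fin.Properties
  using (_≟_; toℕ<n; toℕ-injective; toℕ-fromℕ<; fromℕ≢inject₁; inject₁-injective)
open import Data.List using (length; filter; tabulate)
open import Data.Nat using (zero; suc; pred; _+_; _*_; _<_; _<?_; z≤n; s≤s; NonZero)
  renaming (_≟_ to _≟ℕ_)
open import Data.Nat.DivMod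
  using (_mod_; _/_; m%n<n; m%n≤m; m<n⇒m%n≡m; [m+n]%n≡m%n; %-distribˡ-+; %-distribˡ-*;
         m%n%n≡m%n; m≡m%n+[m/n]*n)
open import Data.Nat.Divisibility using (_∣_; divides; m%n≡0⇒n∣m)
open import Data.Nat.Properties
  using (+-comm; +-assoc; +-suc; +-identityʳ; *-identityˡ; suc-pred; *-monoʳ-≤; <⇒≤; ≤-refl;
         ≮⇒≥; +-cancelˡ-<; m≤n⇒∃[o]m+o≡n; m<n⇒0<n; module ≤-Reasoning)
open import Data.Product using (∃-syntax; _,_)
open import Function using (_∘_; _⇔_; mk⇔; Equivalence)
open Equivalence using (to; from)
open import Relation.Nullary using (¬_; does; yes; no)
open import Relation.Nullary.Decidable using (dec-true; does-⇔)
open import Relation.Binary.PropositionalEquality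
  using (refl; sym; trans; cong; cong₂; subst; module ≡-Reasoning)

indicator : Bool → ℕ
indicator true  = 1
indicator false = 0

count-tabulate : ∀ {m n} (p : Fin m → Bool) (f : Fin n → Fin m) →
  length (filter (λ i → p i ≟ᵇ true) (tabulate f)) ≡ count (p ∘ f)
count-tabulate {n = zero}  p f = refl
count-tabulate {n = suc n} p f with p (f zero)
... | true  = cong suc (trans (count-tabulate p (f ∘ suc)) (sym (count-tabulate (p ∘ f) suc)))
... | false = trans (count-tabulate p (f ∘ suc)) (sym (count-tabulate (p ∘ f) suc))

count-suc : ∀ {n} (p : Fin (suc n) → Bool) → count p ≡ indicator (p zero) + count (p ∘ suc)
count-suc p with p zero
... | true  = cong suc (count-tabulate p suc)
... | false = count-tabulate p suc

count-none : ∀ {n} {p : Fin n → Bool} → (∀ u → p u ≡ false) → count p ≡ 0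
count-none {zero}  p≡ = refl
count-none {suc n} {p} p≡ rewrite count-suc p | p≡ zero = count-none (p≡ ∘ suc)

count-single : ∀ {n} {p q : Fin n → Bool} (a : Fin n) →
  (∀ u → p u ≡ does (u ≟ a) ∧ q u) → count p ≡ indicator (q a)
count-single {suc n} {p} zero    p≡ rewrite count-suc p | p≡ zero | count-none (p≡ ∘ suc) =
  +-identityʳ _
count-single {suc n} {p} (suc a) p≡ rewrite count-suc p | p≡ zero = count-single a (p≡ ∘ suc)

count-pair : ∀ {n} {p q : Fin n → Bool} {a b : Fin n} → a ≢ b →
  (∀ u → p u ≡ (does (u ≟ a) ∨ does (u ≟ b)) ∧ q u) → count p ≡ indicator (q a) + indicator (q b)
count-pair {suc n} {a = zero}  {zero}  a≢b p≡ = ⊥-elim (a≢b refl)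
count-pair {suc n} {p} {a = zero}  {suc b} a≢b p≡ rewrite count-suc p | p≡ zero =
  cong (_ +_) (count-single b (p≡ ∘ suc))
count-pair {suc n} {p} {q} {suc a} {zero}  a≢b p≡ rewrite count-suc p | p≡ zero =
  trans (cong (_ +_) (count-single a λ u →
           trans (p≡ (suc u)) (cong (_∧ q (suc u)) (∨-identityʳ _))))
        (+-comm (indicator (q zero)) _)
count-pair {suc n} {p} {a = suc a} {suc b} a≢b p≡ rewrite count-suc p | p≡ zero =
  count-pair (a≢b ∘ cong suc) (p≡ ∘ suc)

indicator-≢ : ∀ {k} {x y : Fin k} → x ≢ y → ∀ z →
  indicator (does (x ≟ z)) + indicator (does (y ≟ z)) ≤ 1
indicator-≢ {x = x} {y} x≢y z with x ≟ z | y ≟ z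
... | yes refl | yes y≡x = ⊥-elim (x≢y (sym y≡x))
... | yes _    | no _    = ≤-refl
... | no _     | yes _   = ≤-refl
... | no _     | no _    = z≤n

module _ (G : Graph) {v a b : Fin (order G)} (a≢b : a ≢ b)
         (adj-v : ∀ u → adj G v u ≡ does (u ≟ a) ∨ does (u ≟ b)) where

  degree-twoNeighbours : degree G v ≡ 2
  degree-twoNeighbours = count-pair a≢b λ u → trans (adj-v u) (sym (∧-identityʳ _))

  colourDegree-twoNeighbours : ∀ {k} (c : Fin (order G) → Fin k) α →
    colourDegree G c v α ≡ indicator (does (c a ≟ α)) + indicator (does (c b ≟ α))
  colourDegree-twoNeighbours c α = count-pair a≢b λ u → cong (_∧ _) (adj-v u)

  majorityAt-twoNeighbours⇔ : ∀ {k} (c : Fin (order G) → Fin k) →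
    (∀ α → 2 * colourDegree G c v α ≤ degree G v) ⇔ c a ≢ c b
  majorityAt-twoNeighbours⇔ c = mk⇔ majority⇒≢ ≢⇒majority
    where
    open ≤-Reasoning
    colourDegree-≡2 : c a ≡ c b → colourDegree G c v (c a) ≡ 2
    colourDegree-≡2 ca≡cb rewrite colourDegree-twoNeighbours c (c a)
                                | dec-true (c a ≟ c a) refl
                                | dec-true (c b ≟ c a) (sym ca≡cb) = refl
    majority⇒≢ : (∀ α → 2 * colourDegree G c v α ≤ degree G v) → c a ≢ c b
    majority⇒≢ majority ca≡cb with s≤s (s≤s ()) ← begin
      4                             ≡⟨ cong (2 *_) (colourDegree-≡2 ca≡cb) ⟨
      2 * colourDegree G c v (c a)  ≤⟨ majority (c a) ⟩
      degree G v                    ≡⟨ degree-twoNeighbours ⟩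
      2                             ∎
    ≢⇒majority : c a ≢ c b → ∀ α → 2 * colourDegree G c v α ≤ degree G v
    ≢⇒majority ca≢cb α rewrite colourDegree-twoNeighbours c α | degree-twoNeighbours =
      *-monoʳ-≤ 2 (indicator-≢ ca≢cb α)

module _ {n : ℕ} .{{_ : NonZero n}} where

  toℕ-mod : ∀ i → toℕ (i mod n) ≡ i % n
  toℕ-mod i = toℕ-fromℕ< (m%n<n i n)

  [1+i%n]%n≡[1+i]%n : ∀ i → suc (i % n) % n ≡ suc i % n
  [1+i%n]%n≡[1+i]%n i = begin
    (1 + i % n) % n           ≡⟨ %-distribˡ-+ 1 (i % n) n ⟩
    (1 % n + i % n % n) % n   ≡⟨ cong (λ j → (1 % n + j) % n) (m%n%n≡m%n i n) ⟩
    (1 % n + i % n) % n       ≡⟨ %-distribˡ-+ 1 i n ⟨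
    (1 + i) % n               ∎
    where open ≡-Reasoning

  suc-%-injective : ∀ {i j} → suc i % n ≡ suc j % n → i % n ≡ j % n
  suc-%-injective {i} {j} eq = begin
    i % n                         ≡⟨ via-suc i ⟩
    (suc i % n + pred n % n) % n  ≡⟨ cong (λ x → (x + pred n % n) % n) eq ⟩
    (suc j % n + pred n % n) % n  ≡⟨ via-suc j ⟨
    j % n                         ∎
    where
    open ≡-Reasoning
    via-suc : ∀ x → x % n ≡ (suc x % n + pred n % n) % n
    via-suc x = begin
      x % n                         ≡⟨ [m+n]%n≡m%n x n ⟨
      (x + n) % n                   ≡⟨ cong (λ y → (x + y) % n) (suc-pred n) ⟨
      (x + suc (pred n)) % n        ≡⟨ cong (_% n) (+-suc x (pred n)) ⟩
      (suc x + pred n) % n          ≡⟨ %-distribˡ-+ (suc x) (pred n) n ⟩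
      (suc x % n + pred n % n) % n  ∎

  [2+i]%n≢i%n : 2 < n → ∀ i → (2 + i) % n ≢ i % n
  [2+i]%n≢i%n 2<n zero    eq with () ← trans (sym (m<n⇒m%n≡m 2<n))
                                               (trans eq (m<n⇒m%n≡m (m<n⇒0<n 2<n)))
  [2+i]%n≢i%n 2<n (suc i) eq = [2+i]%n≢i%n 2<n i (suc-%-injective eq)

  next : Fin n → Fin n
  next u = suc (toℕ u) mod n

  toℕ-next : ∀ u → toℕ (next u) ≡ suc (toℕ u) % n
  toℕ-next u = toℕ-mod (suc (toℕ u))

  toℕ-next² : ∀ u → toℕ (next (next u)) ≡ (2 + toℕ u) % n
  toℕ-next² u = begin
    toℕ (next (next u))        ≡⟨ toℕ-next (next u) ⟩
    suc (toℕ (next u)) % n     ≡⟨ cong (λ x → suc x % n) (toℕ-next u) ⟩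
    suc (suc (toℕ u) % n) % n  ≡⟨ [1+i%n]%n≡[1+i]%n (suc (toℕ u)) ⟩
    (2 + toℕ u) % n            ∎
    where open ≡-Reasoning

  next-mod : ∀ i → next (i mod n) ≡ suc i mod n
  next-mod i = toℕ-injective (begin
    toℕ (next (i mod n))     ≡⟨ toℕ-next (i mod n) ⟩
    suc (toℕ (i mod n)) % n  ≡⟨ cong (λ x → suc x % n) (toℕ-mod i) ⟩
    suc (i % n) % n          ≡⟨ [1+i%n]%n≡[1+i]%n i ⟩
    suc i % n                ≡⟨ toℕ-mod (suc i) ⟨
    toℕ (suc i mod n)        ∎)
    where open ≡-Reasoning

  mod-periodic : ∀ i → (n + i) mod n ≡ i mod n
  mod-periodic i = toℕ-injective (begin
    toℕ ((n + i) mod n)  ≡⟨ toℕ-mod (n + i) ⟩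
    (n + i) % n          ≡⟨ cong (_% n) (+-comm n i) ⟩
    (i + n) % n          ≡⟨ [m+n]%n≡m%n i n ⟩
    i % n                ≡⟨ toℕ-mod i ⟨
    toℕ (i mod n)        ∎)
    where open ≡-Reasoning

  toℕ%n≡toℕ : ∀ u → toℕ u % n ≡ toℕ u
  toℕ%n≡toℕ u = m<n⇒m%n≡m (toℕ<n u)

  next≡⇔ : ∀ {u w} → suc (toℕ u) % n ≡ toℕ w ⇔ next u ≡ w
  next≡⇔ {u} = mk⇔ (λ eq → toℕ-injective (trans (toℕ-next u) eq))
                   (λ eq → trans (sym (toℕ-next u)) (cong toℕ eq))

  next-injective : ∀ {u w} → next u ≡ next w → u ≡ w
  next-injective {u} {w} eq = toℕ-injective (begin
    toℕ u            ≡⟨ toℕ%n≡toℕ u ⟨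
    toℕ u % n        ≡⟨ suc-%-injective (begin
                          suc (toℕ u) % n  ≡⟨ toℕ-next u ⟨
                          toℕ (next u)     ≡⟨ cong toℕ eq ⟩
                          toℕ (next w)     ≡⟨ toℕ-next w ⟩
                          suc (toℕ w) % n  ∎) ⟩
    toℕ w % n        ≡⟨ toℕ%n≡toℕ w ⟩
    toℕ w            ∎)
    where open ≡-Reasoning

  next²≢ : 2 < n → ∀ w → next (next w) ≢ w
  next²≢ 2<n w eq = [2+i]%n≢i%n 2<n (toℕ w) (begin
    (2 + toℕ w) % n      ≡⟨ toℕ-next² w ⟨
    toℕ (next (next w))  ≡⟨ cong toℕ eq ⟩
    toℕ w                ≡⟨ toℕ%n≡toℕ w ⟨
    toℕ w % n            ∎)
    where open ≡-Reasoning

  prev : Fin n → Fin n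
  prev v = (toℕ v + pred n) mod n

  next-prev : ∀ v → next (prev v) ≡ v
  next-prev v = toℕ-injective (begin
    toℕ (next (prev v))               ≡⟨ cong toℕ (next-mod (toℕ v + pred n)) ⟩
    toℕ (suc (toℕ v + pred n) mod n)  ≡⟨ toℕ-mod _ ⟩
    suc (toℕ v + pred n) % n          ≡⟨ cong (_% n) (+-suc (toℕ v) (pred n)) ⟨
    (toℕ v + suc (pred n)) % n        ≡⟨ cong (λ x → (toℕ v + x) % n) (suc-pred n) ⟩
    (toℕ v + n) % n                   ≡⟨ [m+n]%n≡m%n (toℕ v) n ⟩
    toℕ v % n                         ≡⟨ toℕ%n≡toℕ v ⟩
    toℕ v                             ∎)
    where open ≡-Reasoning

n≤j<n+d⇒j%n<d : ∀ {n j d} .{{_ : NonZero n}} → n ≤ j → j < n + d → j % n < d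
n≤j<n+d⇒j%n<d {n} {j} {d} n≤j j<n+d with o , refl ← m≤n⇒∃[o]m+o≡n n≤j = begin-strict
  (n + o) % n  ≡⟨ cong (_% n) (+-comm n o) ⟩
  (o + n) % n  ≡⟨ [m+n]%n≡m%n o n ⟩
  o % n        ≤⟨ m%n≤m o n ⟩
  o            <⟨ +-cancelˡ-< n o d j<n+d ⟩
  d            ∎
  where open ≤-Reasoning

multiple≡2-mod-4 : ∀ n → n % 4 ≢ 0 → ∃[ k ] (k * n) % 4 ≡ 2
multiple≡2-mod-4 n n%4≢0 with n % 4 in n%4≡r | m%n<n n 4
... | 0 | _ = ⊥-elim (n%4≢0 refl)
... | 1 | _ = 2 , trans (%-distribˡ-* 2 n 4) (cong (λ r → (2 * r) % 4) n%4≡r)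
... | 2 | _ = 1 , trans (cong (_% 4) (*-identityˡ n)) n%4≡r
... | 3 | _ = 2 , trans (%-distribˡ-* 2 n 4) (cong (λ r → (2 * r) % 4) n%4≡r)
... | suc (suc (suc (suc _))) | s≤s (s≤s (s≤s (s≤s ())))

Periodic : ∀ {A : Set} → ℕ → (ℕ → A) → Set
Periodic p f = ∀ i → f (p + i) ≡ f i

module _ {A : Set} {p : ℕ} {f : ℕ → A} (periodic : Periodic p f) where

  periodic-* : ∀ t i → f (t * p + i) ≡ f i
  periodic-* zero    i = refl
  periodic-* (suc t) i = begin
    f (p + t * p + i)    ≡⟨ cong f (+-assoc p (t * p) i) ⟩
    f (p + (t * p + i))  ≡⟨ periodic (t * p + i) ⟩
    f (t * p + i)        ≡⟨ periodic-* t i ⟩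
    f i                  ∎
    where open ≡-Reasoning

  periodic-∣ : ∀ {q} → p ∣ q → Periodic q f
  periodic-∣ (divides t refl) = periodic-* t

  periodic-% : .{{_ : NonZero p}} → ∀ i → f (i % p) ≡ f i
  periodic-% i = trans (sym (periodic-* (i / p) (i % p)))
                       (cong f (trans (+-comm _ (i % p)) (sym (m≡m%n+[m/n]*n i p))))

≢-≢⇒≡ : ∀ {x y z : Fin 2} → x ≢ y → y ≢ z → x ≡ z
≢-≢⇒≡ {zero}     {zero}     {_}        x≢y _   = ⊥-elim (x≢y refl)
≢-≢⇒≡ {suc zero} {suc zero} {_}        x≢y _   = ⊥-elim (x≢y refl)
≢-≢⇒≡ {zero}     {suc zero} {suc zero} _   y≢z = ⊥-elim (y≢z refl)
≢-≢⇒≡ {suc zero} {zero}     {zero}     _   y≢z = ⊥-elim (y≢z refl)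
≢-≢⇒≡ {zero}     {suc zero} {zero}     _   _   = refl
≢-≢⇒≡ {suc zero} {zero}     {suc zero} _   _   = refl

alternating-periodic : ∀ {f : ℕ → Fin 2} → (∀ i → f i ≢ f (2 + i)) → Periodic 4 f
alternating-periodic alternating i = sym (≢-≢⇒≡ (alternating i) (alternating (2 + i)))

alternating-period%4≡0 : ∀ {n} {f : ℕ → Fin 2} →
  (∀ i → f i ≢ f (2 + i)) → Periodic n f → n % 4 ≡ 0
alternating-period%4≡0 {n} {f} alternating periodic with n % 4 ≟ℕ 0
... | yes n%4≡0 = n%4≡0
... | no  n%4≢0 with k , kn%4≡2 ← multiple≡2-mod-4 n n%4≢0 = ⊥-elim (alternating 0 (begin
  f 0              ≡⟨ periodic-* periodic k 0 ⟨
  f (k * n + 0)    ≡⟨ cong f (+-identityʳ (k * n)) ⟩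
  f (k * n)        ≡⟨ periodic-% (alternating-periodic alternating) (k * n) ⟨
  f ((k * n) % 4)  ≡⟨ cong f kn%4≡2 ⟩
  f 2              ∎))
  where open ≡-Reasoning

aabb : ∀ {A : Set} → A → A → ℕ → A
aabb a b 0             = a
aabb a b 1             = a
aabb a b (suc (suc i)) = aabb b a i

aabb-alternating : ∀ {A : Set} {a b : A} → a ≢ b → ∀ i → aabb a b i ≢ aabb a b (2 + i)
aabb-alternating a≢b 0             = a≢b
aabb-alternating a≢b 1             = a≢b
aabb-alternating a≢b (suc (suc i)) = aabb-alternating (a≢b ∘ sym) i

aabb-periodic : ∀ {A : Set} {a b : A} → Periodic 4 (aabb a b)
aabb-periodic i = refl

recolourFirstTwo : ∀ {k} → (ℕ → Fin k) → ℕ → Fin (suc k)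
recolourFirstTwo {k} f 0                 = fromℕ k
recolourFirstTwo {k} f 1                 = fromℕ k
recolourFirstTwo     f i@(suc (suc _))   = inject₁ (f i)

recolourFirstTwo-<2 : ∀ {k} (f : ℕ → Fin k) {i} → i < 2 → recolourFirstTwo f i ≡ fromℕ k
recolourFirstTwo-<2 f {0} _ = refl
recolourFirstTwo-<2 f {1} _ = refl
recolourFirstTwo-<2 f {suc (suc _)} (s≤s (s≤s ()))

recolourFirstTwo-alternating : ∀ {k n} .{{_ : NonZero n}} {f : ℕ → Fin k} →
  (∀ i → f i ≢ f (2 + i)) → 4 ≤ n → ∀ i → i < n →
  recolourFirstTwo f i ≢ recolourFirstTwo f ((2 + i) % n)
recolourFirstTwo-alternating _ 4≤n 0 _ rewrite m<n⇒m%n≡m {m = 2} (<⇒≤ 4≤n) = fromℕ≢inject₁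
recolourFirstTwo-alternating _ 4≤n 1 _ rewrite m<n⇒m%n≡m {m = 3} 4≤n = fromℕ≢inject₁
recolourFirstTwo-alternating {n = n} {f} alternating _ (suc (suc i)) i<n with 4 + i <? n
... | yes 4+i<n rewrite m<n⇒m%n≡m 4+i<n = alternating (2 + i) ∘ inject₁-injective
... | no  4+i≮n = λ eq → fromℕ≢inject₁ (sym (trans eq (recolourFirstTwo-<2 f wraps)))
  where
  wraps : (4 + i) % n < 2
  wraps = n≤j<n+d⇒j%n<d (≮⇒≥ 4+i≮n) (subst (4 + i <_) (+-comm 2 n) (s≤s (s≤s i<n)))

module _ (m : ℕ) where

  private
    n : ℕ
    n = 3 + m

    -- Cycle only computes once its proof of 3 ≤ n is a constructor term.
    C : Graph
    C = Cycle n (s≤s (s≤s (s≤s z≤n)))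

    2<n : 2 < n
    2<n = s≤s (s≤s (s≤s z≤n))

  cycle-adj-next : ∀ w u → adj C (next w) u ≡ does (u ≟ next (next w)) ∨ does (u ≟ w)
  cycle-adj-next w u = cong₂ _∨_
    (does-⇔ successor (suc (toℕ (next w)) % n ≟ℕ toℕ u) (u ≟ next (next w)))
    (does-⇔ predecessor (suc (toℕ u) % n ≟ℕ toℕ (next w)) (u ≟ w))
    where
    successor : suc (toℕ (next w)) % n ≡ toℕ u ⇔ u ≡ next (next w)
    successor = mk⇔ (sym ∘ to next-w≡u) (from next-w≡u ∘ sym)
      where
      next-w≡u : suc (toℕ (next w)) % n ≡ toℕ u ⇔ next (next w) ≡ u
      next-w≡u = next≡⇔ {u = next w} {u}
    predecessor : suc (toℕ u) % n ≡ toℕ (next w) ⇔ u ≡ w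
    predecessor = mk⇔ (next-injective ∘ to next-u≡) (from next-u≡ ∘ cong next)
      where
      next-u≡ : suc (toℕ u) % n ≡ toℕ (next w) ⇔ next u ≡ next w
      next-u≡ = next≡⇔ {u = u} {next w}

  cycle-majority⇔ : ∀ {k} (c : Fin n → Fin k) →
    IsStrongMajority C c ⇔ (∀ w → c w ≢ c (next (next w)))
  cycle-majority⇔ c = mk⇔
    (λ majority w → to (majorityAt-next⇔ w) (majority (next w)) ∘ sym)
    (λ apart v → subst MajorityAt (next-prev v)
                   (from (majorityAt-next⇔ (prev v)) (apart (prev v) ∘ sym)))
    where
    MajorityAt : Fin n → Set
    MajorityAt v = ∀ α → 2 * colourDegree C c v α ≤ degree C v
    majorityAt-next⇔ : ∀ w → MajorityAt (next w) ⇔ c (next (next w)) ≢ c w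
    majorityAt-next⇔ w = majorityAt-twoNeighbours⇔ C (next²≢ 2<n w) (cycle-adj-next w) c

  ¬majColourable-0 : ¬ MajColourable C 0
  ¬majColourable-0 (c , _) with c zero
  ... | ()

  ¬majColourable-1 : ¬ MajColourable C 1
  ¬majColourable-1 (c , majority) = to (cycle-majority⇔ c) majority zero (fin1 _ _)
    where
    fin1 : (x y : Fin 1) → x ≡ y
    fin1 zero zero = refl

  majColourable-2⇒%4≡0 : MajColourable C 2 → n % 4 ≡ 0
  majColourable-2⇒%4≡0 (c , majority) =
    alternating-period%4≡0 {n} {c ∘ (_mod n)} alternating (cong c ∘ mod-periodic)
    where
    alternating : ∀ i → c (i mod n) ≢ c ((2 + i) mod n)
    alternating i = subst (λ v → c (i mod n) ≢ c v)
                          (trans (cong next (next-mod i)) (next-mod (suc i)))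
                          (to (cycle-majority⇔ c) majority (i mod n))

  majColourable-from-ℕ : ∀ {k} (g : ℕ → Fin k) →
    (∀ i → i < n → g i ≢ g ((2 + i) % n)) → MajColourable C k
  majColourable-from-ℕ g apart = g ∘ toℕ , from (cycle-majority⇔ (g ∘ toℕ)) λ w →
    subst (λ j → g (toℕ w) ≢ g j) (sym (toℕ-next² w)) (apart (toℕ w) (toℕ<n w))

  majColourable-2 : n % 4 ≡ 0 → MajColourable C 2
  majColourable-2 n%4≡0 = majColourable-from-ℕ colouring λ i _ eq →
    aabb-alternating (λ ()) i (trans eq (colouring-% (2 + i)))
    where
    colouring : ℕ → Fin 2
    colouring = aabb zero (suc zero)
    colouring-% : ∀ j → colouring (j % n) ≡ colouring j
    colouring-% = periodic-% (periodic-∣ aabb-periodic (m%n≡0⇒n∣m n 4 n%4≡0))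

  majColourable-identity : MajColourable C n
  majColourable-identity = (λ v → v) , from (cycle-majority⇔ (λ v → v)) λ w → next²≢ 2<n w ∘ sym

  majColourable-recoloured : 4 ≤ n → MajColourable C 3
  majColourable-recoloured 4≤n = majColourable-from-ℕ (recolourFirstTwo (aabb zero (suc zero)))
    (recolourFirstTwo-alternating {n = n} (aabb-alternating (λ ())) 4≤n)

majColourable-3 : ∀ m → MajColourable (Cycle (3 + m) (s≤s (s≤s (s≤s z≤n)))) 3
majColourable-3 zero    = majColourable-identity 0
majColourable-3 (suc m) = majColourable-recoloured (suc m) (s≤s (s≤s (s≤s (s≤s z≤n))))

mainTheorem3 : (n : ℕ) → (h : 3 ≤ n) →
    ((n % 4 ≡ 0) → MajNumber (Cycle n h) 2) ×
    ((n % 4 ≢ 0) → MajNumber (Cycle n h) 3)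
mainTheorem3 (suc (suc (suc m))) (s≤s (s≤s (s≤s z≤n))) =
    (λ n%4≡0 → majColourable-2 m n%4≡0 , λ
      { 0 _ → ¬majColourable-0 m
      ; 1 _ → ¬majColourable-1 m
      ; (suc (suc _)) (s≤s (s≤s ())) })
  , (λ n%4≢0 → majColourable-3 m , λ
      { 0 _ → ¬majColourable-0 m
      ; 1 _ → ¬majColourable-1 m
      ; 2 _ → n%4≢0 ∘ majColourable-2⇒%4≡0 m
      ; (suc (suc (suc _))) (s≤s (s≤s (s≤s ()))) })
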